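{- Let $t$ be a nonnegative integer and let $H$ be a graph with girth at least $5$ that is not $(1,t)$-colorable but every proper subgraph of $H$ is $(1,t)$-colorable. Then $H$ has at least three vertices of degree at least $t+2$.
   Context: All graphs are finite and simple. A graph $H$ is $(1,t)$-colorable if $V(H)$ can be partitioned into two sets $V_1,V_2$ such that the subgraph induced by $V_1$ has maximum degree at most $1$ and the subgraph induced by $V_2$ has maximum degree at most $t$. The girth is the length of a shortest cycle. -}

module Defs where

open import Data.Nat using (ℕ; zero; suc; _+_; _≤_)
open import Data.Fin using (Fin; zero; suc; toℕ; fromℕ)
open import Data.Bool using (Bool; true; false; T; _∧_; if_then_else_)
open import Data.Product using (Σ; ∃; _×_; _,_)
open import Data.Sum using (_⊎_)
open import Relation.Binary.PropositionalEquality using (_≡_; _≢_)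
open import Relation.Nullary using (¬_)
open import Function.Definitions using (Injective)

record Graph (n : ℕ) : Set where
  field
    adj   : Fin n → Fin n → Bool
    sym   : ∀ u v → adj u v ≡ adj v u
    irrefl : ∀ v → adj v v ≡ false
open Graph public

count : ∀ {n} → (Fin n → Bool) → ℕ
count {zero} p = 0
count {suc n} p = (if p zero then 1 else 0) + count (λ i → p (suc i))

degree : ∀ {n} → Graph n → Fin n → ℕ
degree G v = count (adj G v)

-- A cycle of length (suc m) in G: an injective sequence of vertices
-- with consecutive ones adjacent and the last adjacent to the first.
record Cycle {n : ℕ} (G : Graph n) (m : ℕ) : Set where
  field
    vtx    : Fin (suc m) → Fin n
    inj    : Injective _≡_ _≡_ vtx
    step   : ∀ (i j : Fin (suc m)) → toℕ j ≡ suc (toℕ i) → T (adj G (vtx i) (vtx j))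
    close  : T (adj G (vtx (fromℕ m)) (vtx zero))

GirthAtLeast : ∀ {n} → Graph n → ℕ → Set
GirthAtLeast G g = ∀ m → 3 ≤ suc m → Cycle G m → g ≤ suc m

record Subgraph {n : ℕ} (G : Graph n) : Set where
  field
    S      : Fin n → Bool
    F      : Fin n → Fin n → Bool
    F-sym  : ∀ u v → F u v ≡ F v u
    F-adj  : ∀ u v → T (F u v) → T (adj G u v)
    F-inS  : ∀ u v → T (F u v) → T (S u) × T (S v)
open Subgraph public

Proper : ∀ {n} {G : Graph n} → Subgraph G → Set
Proper {n} {G} H =
  (∃ λ v → ¬ T (S H v)) ⊎ (∃ λ u → ∃ λ v → T (adj G u v) × ¬ T (F H u v))

whole : ∀ {n} (G : Graph n) → Subgraph G
whole G = record
  { S = λ _ → true ; F = adj G ; F-sym = sym G ; F-adj = λ u v p → p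
  ; F-inS = λ u v p → _ , _ }

-- bound for a colour class: class 'true' is V₁ (max degree ≤ 1),
-- class 'false' is V₂ (max degree ≤ t)
classBound : ℕ → Bool → ℕ
classBound t true  = 1
classBound t false = t

_≡ᵇ_ : Bool → Bool → Bool
true  ≡ᵇ b = b
false ≡ᵇ true = false
false ≡ᵇ false = true

OneTColorable : ∀ {n} {G : Graph n} → ℕ → Subgraph G → Set
OneTColorable {n} t H =
  Σ (Fin n → Bool) λ c →
    ∀ v → T (S H v) →
      count (λ u → S H u ∧ (F H v u ∧ (c u ≡ᵇ c v))) ≤ classBound t (c v)

module Submission where

-- Let X be the set of vertices of degree at least t+2.  If some
-- vertex of X has two neighbours in X, these three vertices are the required
-- ones.  Otherwise every vertex of X has at most one neighbour in X, and H
-- is (1,t)-colourable, contradicting the hypothesis.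
--
-- The colouring: extend X greedily to a set D such that every edge inside D
-- already lies inside X, and every vertex lies in D or has a neighbour in D.
-- Put V₁ = D and V₂ = the rest.  A vertex of D has its D-neighbours in X, so
-- at most one of them.  A vertex outside D is outside X, so it has degree at
-- most t+1, and one of its neighbours is in D, leaving at most t in V₂.

open import Defs
open import Data.Nat using (ℕ; zero; suc; _+_; _≤_; z≤n; _≤ᵇ_; _≤?_)
open import Data.Nat.Properties
  using (≤-refl; ≤-trans; ≤-reflexive; +-mono-≤; +-suc; +-comm; ≰⇒>; ≤-pred; ≤ᵇ⇒≤; ≤⇒≤ᵇ)
open import Data.Fin using (Fin; zero; suc; _≟_)
open import Data.Fin.Properties using (any?; suc-injective)
open import Data.Bool using (Bool; true; false; T; _∧_; if_then_else_)
open import Data.Product using (Σ; _×_; _,_; ∃; proj₁; proj₂)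
open import Data.Sum using (_⊎_; inj₁; inj₂)
open import Data.Empty using (⊥-elim)
open import Data.Unit using (tt)
open import Data.List using (List; []; _∷_; allFin)
open import Data.List.Membership.Propositional using (_∈_)
open import Data.List.Membership.Propositional.Properties using (∈-allFin)
open import Data.List.Relation.Unary.Any using (here; there)
open import Relation.Binary.PropositionalEquality using (_≡_; _≢_; refl; subst)
  renaming (sym to ≡-sym)
open import Relation.Nullary using (¬_; yes; no)
open import Relation.Nullary.Decidable using (⌊_⌋; _×-dec_; T?)

_⊆_ : ∀ {n} → (Fin n → Bool) → (Fin n → Bool) → Set
p ⊆ q = ∀ u → T (p u) → T (q u)

adjacent-distinct : ∀ {n} (H : Graph n) {u v} → T (adj H u v) → u ≢ v
adjacent-distinct H {u} uv refl = subst T (irrefl H u) uv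

T-∧ : ∀ {x y} → T (x ∧ y) → T x × T y
T-∧ {true} p = tt , p

∧-T : ∀ {x y} → T x → T y → T (x ∧ y)
∧-T {true} _ q = q

bit : Bool → ℕ
bit x = if x then 1 else 0

bit-mono : ∀ {x y} → (T x → T y) → bit x ≤ bit y
bit-mono {false} h = z≤n
bit-mono {true} {true} h = ≤-refl
bit-mono {true} {false} h = ⊥-elim (h tt)

count-mono : ∀ {n} {p q : Fin n → Bool} → p ⊆ q → count p ≤ count q
count-mono {zero} h = z≤n
count-mono {suc n} h = +-mono-≤ (bit-mono (h zero)) (count-mono (λ u → h (suc u)))

count-strict : ∀ {n} {p q : Fin n → Bool} → p ⊆ q
  → ∀ w → T (q w) → ¬ T (p w) → suc (count p) ≤ count q
count-strict {suc n} {p} {q} h zero qw ¬pw =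
  +-mono-≤ (strict (q zero) (p zero) qw ¬pw) (count-mono (λ u → h (suc u)))
  where
    strict : ∀ x y → T x → ¬ T y → suc (bit y) ≤ bit x
    strict true false _ _ = ≤-refl
    strict _ true _ ¬y = ⊥-elim (¬y tt)
count-strict {suc n} {p} h (suc w) qw ¬pw =
  ≤-trans (≤-reflexive (≡-sym (+-suc (bit (p zero)) _)))
    (+-mono-≤ (bit-mono (h zero)) (count-strict (λ u → h (suc u)) w qw ¬pw))

count-none : ∀ {n} (p : Fin n → Bool) → (∀ u → ¬ T (p u)) → count p ≤ 0
count-none {zero} p none = z≤n
count-none {suc n} p none with p zero in eq
... | true = ⊥-elim (none zero (subst T (≡-sym eq) tt))
... | false = count-none (λ i → p (suc i)) (λ u → none (suc u))

count-witness : ∀ {n} (p : Fin n → Bool) → 1 ≤ count p → ∃ λ u → T (p u)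
count-witness {suc n} p pos with p zero in eq
... | true = zero , subst T (≡-sym eq) tt
... | false with count-witness (λ i → p (suc i)) pos
...   | u , pu = suc u , pu

count-two : ∀ {n} (p : Fin n → Bool) → 2 ≤ count p
  → Σ (Fin n) λ u → Σ (Fin n) λ w → u ≢ w × T (p u) × T (p w)
count-two {suc n} p two with p zero in eq
... | true with count-witness (λ i → p (suc i)) (≤-pred two)
...   | w , pw = zero , suc w , (λ ()) , subst T (≡-sym eq) tt , pw
count-two {suc n} p two | false with count-two (λ i → p (suc i)) two
...   | u , w , u≢w , pu , pw = suc u , suc w , (λ e → u≢w (suc-injective e)) , pu , pw

module DominatingExtension {n : ℕ} (H : Graph n) (X : Fin n → Bool) where

  Dominates : (Fin n → Bool) → Fin n → Set
  Dominates D v = T (D v) ⊎ ∃ λ u → T (adj H v u) × T (D u)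

  EdgesWithinSeed : (Fin n → Bool) → Set
  EdgesWithinSeed D = ∀ u w → T (adj H u w) → T (D u) → T (D w) → T (X u) × T (X w)

  private
    insert : Fin n → (Fin n → Bool) → Fin n → Bool
    insert v D u = if ⌊ u ≟ v ⌋ then true else D u

    insert-⊇ : ∀ v D → D ⊆ insert v D
    insert-⊇ v D u p with u ≟ v
    ... | yes _ = tt
    ... | no _ = p

    insert-∋ : ∀ v D → T (insert v D v)
    insert-∋ v D with v ≟ v
    ... | yes _ = tt
    ... | no v≢v = ⊥-elim (v≢v refl)

    insert-cases : ∀ v D u → T (insert v D u) → u ≡ v ⊎ T (D u)
    insert-cases v D u p with u ≟ v
    ... | yes e = inj₁ e
    ... | no _ = inj₂ p

    step : Fin n → (Fin n → Bool) → Fin n → Bool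
    step v D with any? (λ u → T? (adj H v u ∧ D u))
    ... | yes _ = D
    ... | no _ = insert v D

    step-⊇ : ∀ v D → D ⊆ step v D
    step-⊇ v D with any? (λ u → T? (adj H v u ∧ D u))
    ... | yes _ = λ u p → p
    ... | no _ = insert-⊇ v D

    step-dominates : ∀ v D → Dominates (step v D) v
    step-dominates v D with any? (λ u → T? (adj H v u ∧ D u))
    ... | yes (u , p) = inj₂ (u , T-∧ p)
    ... | no _ = inj₁ (insert-∋ v D)

    -- v is only added when it has no neighbour in D, so no new edge arises
    step-edges : ∀ v D → EdgesWithinSeed D → EdgesWithinSeed (step v D)
    step-edges v D old with any? (λ u → T? (adj H v u ∧ D u))
    ... | yes _ = old
    ... | no isolated = λ u w uw Du Dw → edge u w uw (insert-cases v D u Du) (insert-cases v D w Dw)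
      where
        edge : ∀ u w → T (adj H u w) → u ≡ v ⊎ T (D u) → w ≡ v ⊎ T (D w) → T (X u) × T (X w)
        edge u w uw (inj₁ refl) (inj₁ refl) = ⊥-elim (adjacent-distinct H uw refl)
        edge u w uw (inj₁ refl) (inj₂ Dw) = ⊥-elim (isolated (w , ∧-T uw Dw))
        edge u w uw (inj₂ Du) (inj₁ refl) = ⊥-elim (isolated (u , ∧-T (subst T (sym H u w) uw) Du))
        edge u w uw (inj₂ Du) (inj₂ Dw) = old u w uw Du Dw

    dominates-mono : ∀ {D D'} v → D ⊆ D' → Dominates D v → Dominates D' v
    dominates-mono v D⊆D' (inj₁ Dv) = inj₁ (D⊆D' v Dv)
    dominates-mono v D⊆D' (inj₂ (u , vu , Du)) = inj₂ (u , vu , D⊆D' u Du)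

    run : List (Fin n) → (Fin n → Bool) → Fin n → Bool
    run [] D = D
    run (v ∷ vs) D = run vs (step v D)

    run-⊇ : ∀ vs D → D ⊆ run vs D
    run-⊇ [] D u p = p
    run-⊇ (v ∷ vs) D u p = run-⊇ vs (step v D) u (step-⊇ v D u p)

    run-edges : ∀ vs D → EdgesWithinSeed D → EdgesWithinSeed (run vs D)
    run-edges [] D e = e
    run-edges (v ∷ vs) D e = run-edges vs (step v D) (step-edges v D e)

    run-dominates : ∀ vs D v → v ∈ vs → Dominates (run vs D) v
    run-dominates (v ∷ vs) D .v (here refl) =
      dominates-mono v (run-⊇ vs (step v D)) (step-dominates v D)
    run-dominates (w ∷ vs) D v (there v∈vs) = run-dominates vs (step w D) v v∈vs

  dominatingExtension : Σ (Fin n → Bool) λ D →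
    X ⊆ D × EdgesWithinSeed D × (∀ v → Dominates D v)
  dominatingExtension =
    run (allFin n) X
    , run-⊇ (allFin n) X
    , run-edges (allFin n) X (λ u w _ Xu Xw → Xu , Xw)
    , λ v → run-dominates (allFin n) X v (∈-allFin v)

≡ᵇ-true : ∀ {x} → T (x ≡ᵇ true) → T x
≡ᵇ-true {true} _ = tt

≡ᵇ-false : ∀ {x} → T (x ≡ᵇ false) → ¬ T x
≡ᵇ-false {true} ()

colourable-from : (t : ℕ) {n : ℕ} (H : Graph n) (X : Fin n → Bool)
  → (∀ v → T (X v) → count (λ u → adj H v u ∧ X u) ≤ 1)
  → (∀ v → ¬ T (X v) → degree H v ≤ suc t)
  → OneTColorable t (whole H)
colourable-from t {n} H X sparse low = D , λ v _ → bound v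
  where
    open DominatingExtension H X
    D : Fin n → Bool
    D = proj₁ dominatingExtension
    X⊆D : X ⊆ D
    X⊆D = proj₁ (proj₂ dominatingExtension)
    edges : EdgesWithinSeed D
    edges = proj₁ (proj₂ (proj₂ dominatingExtension))
    dominated : ∀ v → Dominates D v
    dominated = proj₂ (proj₂ (proj₂ dominatingExtension))

    -- a vertex of V₁ = D: its V₁-neighbours lie in X, and then so does v
    inV₁ : ∀ v → T (D v) → count (λ u → adj H v u ∧ (D u ≡ᵇ true)) ≤ 1
    inV₁ v Dv with T? (X v)
    ... | yes Xv = ≤-trans (count-mono seedNeighbour) (sparse v Xv)
      where
        seedNeighbour : ∀ u → T (adj H v u ∧ (D u ≡ᵇ true)) → T (adj H v u ∧ X u)
        seedNeighbour u p with T-∧ p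
        ... | vu , Du = ∧-T vu (proj₂ (edges v u vu Dv (≡ᵇ-true Du)))
    ... | no ¬Xv = ≤-trans (count-none _ noNeighbour) z≤n
      where
        noNeighbour : ∀ u → ¬ T (adj H v u ∧ (D u ≡ᵇ true))
        noNeighbour u p with T-∧ p
        ... | vu , Du = ¬Xv (proj₁ (edges v u vu Dv (≡ᵇ-true Du)))

    -- a vertex of V₂ has degree ≤ t+1 and a neighbour in V₁
    inV₂ : ∀ v → ¬ T (D v) → count (λ u → adj H v u ∧ (D u ≡ᵇ false)) ≤ t
    inV₂ v ¬Dv with dominated v
    ... | inj₁ Dv = ⊥-elim (¬Dv Dv)
    ... | inj₂ (w , vw , Dw) =
      ≤-pred (≤-trans
        (count-strict (λ u p → proj₁ (T-∧ p)) w vw (λ p → ≡ᵇ-false (proj₂ (T-∧ {adj H v w} p)) Dw))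
        (low v (λ Xv → ¬Dv (X⊆D v Xv))))

    bound : ∀ v → count (λ u → adj H v u ∧ (D u ≡ᵇ D v)) ≤ classBound t (D v)
    bound v with D v in eq
    ... | true = inV₁ v (subst T (≡-sym eq) tt)
    ... | false = inV₂ v (λ Dv → subst T eq Dv)

highDegree : (t : ℕ) {n : ℕ} → Graph n → Fin n → Bool
highDegree t H v = t + 2 ≤ᵇ degree H v

highDegree-sound : ∀ t {n} (H : Graph n) v → T (highDegree t H v) → t + 2 ≤ degree H v
highDegree-sound t H v = ≤ᵇ⇒≤ (t + 2) (degree H v)

lowDegree : ∀ t {n} (H : Graph n) v → ¬ T (highDegree t H v) → degree H v ≤ suc t
lowDegree t H v notHigh =
  ≤-pred (subst (suc (degree H v) ≤_) (+-comm t 2) (≰⇒> (λ le → notHigh (≤⇒≤ᵇ le))))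

lemma4p2 : (t n : ℕ) (H : Graph n) → GirthAtLeast H 5
    → ¬ OneTColorable t (whole H)
    → ((K : Subgraph H) → Proper K → OneTColorable t K)
    → Σ (Fin n) λ a → Σ (Fin n) λ b → Σ (Fin n) λ c →
        (a ≢ b) × (a ≢ c) × (b ≢ c)
        × (t + 2 ≤ degree H a) × (t + 2 ≤ degree H b) × (t + 2 ≤ degree H c)
lemma4p2 t n H _ uncolourable _
  with any? (λ v → T? (highDegree t H v) ×-dec (2 ≤? count (λ u → adj H v u ∧ highDegree t H u)))
... | yes (a , ha , two) with count-two _ two
...   | b , c , b≢c , ab&hb , ac&hc with T-∧ ab&hb | T-∧ ac&hc
...     | ab , hb | ac , hc =
  a , b , c , adjacent-distinct H ab , adjacent-distinct H ac , b≢c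
  , highDegree-sound t H a ha , highDegree-sound t H b hb , highDegree-sound t H c hc
-- otherwise the high vertices induce maximum degree ≤ 1, so H is colourable
lemma4p2 t n H _ uncolourable _ | no none =
  ⊥-elim (uncolourable (colourable-from t H (highDegree t H)
    (λ v hv → ≤-pred (≰⇒> (λ two → none (v , hv , two))))
    (lowDegree t H)))
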